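{- Let $n\ge0$, let $f\colon\{0,1,\dots,n\}\to\mathbb{R}$ be completely monotonic, let $r\ge1$ and let $a_1,\dots,a_r\in\{0,1,\dots,n\}$ be distinct. Let $p$ be the unique real polynomial of degree less than $r$ with $p(a_i)=f(a_i)$ for $i=1,\dots,r$. Then $(f(x)-p(x))\prod_{i=1}^r(a_i-x)\ge0$ for all $x\in\{0,1,\dots,n\}$, and $p$ can be written as $p(x)=\sum_{j=0}^{r-1}c_j\prod_{i=1}^j(a_i-x)$ with $c_0,\dots,c_{r-1}\ge0$.
   Context: With $\Delta f(m)=f(m+1)-f(m)$, $f\colon\{0,\dots,n\}\to\mathbb{R}$ is completely monotonic if $(-1)^k\Delta^kf(i)\ge0$ whenever $k\ge0$ and $0\le i\le n-k$. -}

module Defs where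

open import Level using (Level; _⊔_) renaming (suc to lsuc)
open import Algebra.Bundles using (CommutativeRing)
open import Relation.Binary.Core using (Rel)
open import Relation.Binary.Structures using (IsTotalOrder)
open import Relation.Nullary using (¬_; yes; no)
open import Data.Product using (∃)
open import Data.Nat as ℕ using (ℕ; zero; suc)
open import Data.Fin as Fin using (Fin; toℕ; fromℕ<; inject)
open import Data.Vec using (Vec; []; _∷_)

-- Ordered fields (the real numbers are the intended instance; ℝ is not
-- available in agda-stdlib).
record OrderedField (c ℓ₁ ℓ₂ : Level) : Set (lsuc (c ⊔ ℓ₁ ⊔ ℓ₂)) where
  field
    commutativeRing : CommutativeRing c ℓ₁
  open CommutativeRing commutativeRing public
  field
    _≤_          : Rel Carrier ℓ₂
    isTotalOrder : IsTotalOrder _≈_ _≤_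
    0≉1          : ¬ (0# ≈ 1#)
    inverse      : ∀ x → ¬ (x ≈ 0#) → ∃ λ y → x * y ≈ 1#
    +-mono-≤     : ∀ {x y} z → x ≤ y → (x + z) ≤ (y + z)
    *-nonneg     : ∀ {x y} → 0# ≤ x → 0# ≤ y → 0# ≤ (x * y)

  infixl 6 _∸F_
  _∸F_ : Carrier → Carrier → Carrier
  x ∸F y = x + (- y)

  ι : ℕ → Carrier
  ι zero    = 0#
  ι (suc m) = 1# + ι m

  sgn : ℕ → Carrier
  sgn zero    = 1#
  sgn (suc k) = - sgn k

  Σ[_] : ∀ {m} → (Fin m → Carrier) → Carrier
  Σ[_] {zero}  g = 0#
  Σ[_] {suc m} g = g Fin.zero + Σ[ (λ i → g (Fin.suc i)) ]

  Π[_] : ∀ {m} → (Fin m → Carrier) → Carrier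
  Π[_] {zero}  g = 1#
  Π[_] {suc m} g = g Fin.zero * Π[ (λ i → g (Fin.suc i)) ]

  Δ : (ℕ → Carrier) → ℕ → Carrier
  Δ g m = g (suc m) ∸F g m

  Δ^ : ℕ → (ℕ → Carrier) → ℕ → Carrier
  Δ^ zero    g = g
  Δ^ (suc k) g = Δ (Δ^ k g)

  -- extend f : {0,…,n} → F to ℕ by 0 outside {0,…,n}; the values outside
  -- are never used below (Δ^k f i only uses f i, …, f (i+k), and i+k ≤ n).
  extend : ∀ {n} → (Fin (suc n) → Carrier) → ℕ → Carrier
  extend {n} f m with m ℕ.<? suc n
  ... | yes p = f (fromℕ< p)
  ... | no _  = 0#

  CompletelyMonotonic : ∀ {n} → (Fin (suc n) → Carrier) → Set ℓ₂
  CompletelyMonotonic {n} f =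
    ∀ (k i : ℕ) → i ℕ.+ k ℕ.≤ n → 0# ≤ (sgn k * Δ^ k (extend f) i)

  eval : ∀ {r} → Vec Carrier r → Carrier → Carrier
  eval []       x = 0#
  eval (c ∷ cs) x = c + x * eval cs x

module Submission where

-- Let sdd h [x₀, …, x_k] = (−1)^k [x₀, …, x_k] h be the divided
-- difference carrying the sign of complete monotonicity.  Three facts:
--  (1) sdd h is symmetric in its (distinct) nodes (sdd-perm), because two
--      divided-difference steps commute (a partial-fraction identity);
--  (2) if h is completely monotonic on {0, …, n}, then sdd h L ≥ 0 for any
--      distinct nodes L ⊆ {0, …, n} (sdd-nonneg).  By induction on n: nodes
--      avoiding 0 or n reduce to {0, …, n−1} by translation or restriction;
--      the full set {0, …, n} gives (−1)ⁿ Δⁿ h(0) / n! (sdd-upTo); otherwise a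
--      missing point m writes sdd h L as a positive combination of two
--      divided differences avoiding n resp. 0 (sdd-insert);
--  (3) Newton interpolation: the Newton coefficients of p are
--      c_j = sdd h [a_j, a₀, …, a_{j−1}] and the error is
--      h(x) − p(x) = Π(aᵢ − x) · sdd h [x, a₀, …, a_{r−1}].
-- So c_j ≥ 0, and (h − p)(x) Π(aᵢ − x) is 0 at the nodes and Π² · sdd ≥ 0
-- elsewhere.

open import Defs
open import Level using (Level; _⊔_)
open import Data.Nat using (ℕ; suc) renaming (_≤_ to _≤ℕ_)
open import Data.Fin using (Fin; toℕ; inject)
open import Data.Vec using (Vec; lookup)
open import Data.Product using (Σ; _×_)
open import Relation.Binary.PropositionalEquality using (_≡_)
open import Function.Definitions using (Injective)

open import Data.Nat using (zero; _!)
import Data.Nat as ℕ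
import Data.Nat.Properties as ℕP
open import Data.Integer as ℤ using (ℤ; +_; -[1+_]; _⊖_)
import Data.Integer.Properties as ℤP
import Data.Fin as Fin
import Data.Fin.Properties as FinP
open import Data.Vec using ([]; _∷_)
open import Data.List using (List; []; _∷_; map; upTo; _++_; tabulate)
open import Data.List.Properties using (map-upTo; upTo-∷ʳ; map-∘; map-id-local)
open import Data.List.Membership.Propositional using (_∈_; _∉_)
open import Data.List.Membership.Propositional.Properties
  using (∈-map⁻; ∈-∃++; ∈-upTo⁺; ∈-upTo⁻; ∈-tabulate⁻)
open import Data.List.Membership.Propositional.Properties.WithK using (unique∧set⇒bag)
open import Data.List.Membership.DecPropositional ℕP._≟_ using (_∈?_)
open import Data.List.Relation.Unary.Any using (here; there)
import Data.List.Relation.Unary.All as All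
open import Data.List.Relation.Unary.All using ([]; _∷_)
import Data.List.Relation.Unary.All.Properties as AllP
open import Data.List.Relation.Unary.Unique.Propositional using (Unique; []; _∷_)
import Data.List.Relation.Unary.Unique.Propositional.Properties as Unique
open import Data.List.Relation.Binary.Permutation.Propositional as ↭ using (_↭_; prep; swap; ↭-sym; ↭⇒↭ₛ)
open import Data.List.Relation.Binary.Permutation.Propositional.Properties
  using (∈-resp-↭; All-resp-↭; shift; ∷↭∷ʳ; map⁺)
import Data.List.Relation.Binary.Permutation.Setoid.Properties as ↭ₛ
open import Data.List.Relation.Binary.BagAndSetEquality using (∼bag⇒↭)
open import Data.Maybe using (Maybe; just; nothing)
open import Data.Product using (∃; _,_; proj₁; proj₂)
open import Data.Sum using (inj₁; inj₂)
open import Data.Empty using (⊥-elim)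
open import Function.Bundles using (mk⇔)
open import Relation.Nullary using (¬_; yes; no)
open import Relation.Binary.PropositionalEquality as P using (_≢_)
open import Relation.Binary.Structures using (IsTotalOrder)
open import Algebra.Bundles using (CommutativeRing)
import Algebra.Solver.Ring.AlmostCommutativeRing as ACR

-- It
-- instantiates the ring solver Algebra.Solver.Ring with integer
-- coefficients, which decides ring identities (such as x - x ≈ 0) in R.
-- fromℤ uses the optimised multiple n ×ₙ 1# so that 1 ↦ 1# definitionally.
module IntegerCoefficients {c ℓ : Level} (R : CommutativeRing c ℓ) where
  open CommutativeRing R
  open import Algebra.Properties.Ring ring
    using (-‿distribˡ-*; -‿distribʳ-*; -‿involutive; -0#≈0#; -‿+-comm)
  open import Algebra.Properties.CommutativeSemigroup +-commutativeSemigroup using (interchange)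
  open import Algebra.Properties.Semiring.Mult.TCOptimised semiring
    using (1+×; ×-homo-+; ×1-homo-*) renaming (_×_ to _×ₙ_)
  open import Relation.Binary.Reasoning.Setoid setoid

  fromℤ : ℤ → Carrier
  fromℤ (+ n)      = n ×ₙ 1#
  fromℤ (-[1+ n ]) = - (suc n ×ₙ 1#)

  neg-hom : ∀ i → fromℤ (ℤ.- i) ≈ - fromℤ i
  neg-hom (+ zero)  = sym -0#≈0#
  neg-hom (+ suc n) = refl
  neg-hom -[1+ n ]  = sym (-‿involutive _)

  ⊖-hom : ∀ m n → fromℤ (m ⊖ n) ≈ m ×ₙ 1# - n ×ₙ 1#
  ⊖-hom zero    zero    = sym (-‿inverseʳ 0#)
  ⊖-hom zero    (suc n) = sym (+-identityˡ _)
  ⊖-hom (suc m) zero    = sym (trans (+-congˡ -0#≈0#) (+-identityʳ _))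
  ⊖-hom (suc m) (suc n) = begin
    fromℤ (suc m ⊖ suc n)             ≡⟨ P.cong fromℤ (ℤP.[1+m]⊖[1+n]≡m⊖n m n) ⟩
    fromℤ (m ⊖ n)                     ≈⟨ ⊖-hom m n ⟩
    m ×ₙ 1# - n ×ₙ 1#                 ≈⟨ +-identityˡ _ ⟨
    0# + (m ×ₙ 1# - n ×ₙ 1#)          ≈⟨ +-congʳ (-‿inverseʳ 1#) ⟨
    (1# - 1#) + (m ×ₙ 1# - n ×ₙ 1#)   ≈⟨ interchange _ _ _ _ ⟩
    (1# + m ×ₙ 1#) + (- 1# - n ×ₙ 1#) ≈⟨ +-congˡ (-‿+-comm 1# _) ⟩
    (1# + m ×ₙ 1#) - (1# + n ×ₙ 1#)   ≈⟨ +-cong (1+× m 1#) (-‿cong (1+× n 1#)) ⟨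
    suc m ×ₙ 1# - suc n ×ₙ 1#         ∎

  +-hom : ∀ i j → fromℤ (i ℤ.+ j) ≈ fromℤ i + fromℤ j
  +-hom (+ m)    (+ n)    = ×-homo-+ 1# m n
  +-hom (+ m)    -[1+ n ] = ⊖-hom m (suc n)
  +-hom -[1+ m ] (+ n)    = trans (⊖-hom n (suc m)) (+-comm _ _)
  +-hom -[1+ m ] -[1+ n ] = begin
    fromℤ (-[1+ m ] ℤ.+ -[1+ n ])         ≡⟨ P.cong fromℤ (ℤP.neg-distrib-+ (+ suc m) (+ suc n)) ⟨
    fromℤ (ℤ.- (+ suc m ℤ.+ + suc n))     ≈⟨ neg-hom (+ suc m ℤ.+ + suc n) ⟩
    - fromℤ (+ suc m ℤ.+ + suc n)         ≈⟨ -‿cong (+-hom (+ suc m) (+ suc n)) ⟩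
    - (fromℤ (+ suc m) + fromℤ (+ suc n)) ≈⟨ -‿+-comm _ _ ⟨
    fromℤ (-[1+ m ]) + fromℤ (-[1+ n ])   ∎

  -- multiplicativity is reduced to natural numbers by pulling out signs
  *-hom-pos : ∀ i n → fromℤ (i ℤ.* + n) ≈ fromℤ i * fromℤ (+ n)
  *-hom-pos (+ m)    n = trans (reflexive (P.cong fromℤ (P.sym (ℤP.pos-* m n)))) (×1-homo-* m n)
  *-hom-pos -[1+ m ] n = begin
    fromℤ (ℤ.- (+ suc m) ℤ.* + n)     ≡⟨ P.cong fromℤ (ℤP.neg-distribˡ-* (+ suc m) (+ n)) ⟨
    fromℤ (ℤ.- (+ suc m ℤ.* + n))     ≈⟨ neg-hom (+ suc m ℤ.* + n) ⟩
    - fromℤ (+ suc m ℤ.* + n)         ≈⟨ -‿cong (*-hom-pos (+ suc m) n) ⟩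
    - (fromℤ (+ suc m) * fromℤ (+ n)) ≈⟨ -‿distribˡ-* _ _ ⟩
    fromℤ (-[1+ m ]) * fromℤ (+ n)    ∎

  *-hom : ∀ i j → fromℤ (i ℤ.* j) ≈ fromℤ i * fromℤ j
  *-hom i (+ n)    = *-hom-pos i n
  *-hom i -[1+ n ] = begin
    fromℤ (i ℤ.* ℤ.- (+ suc n))       ≡⟨ P.cong fromℤ (ℤP.neg-distribʳ-* i (+ suc n)) ⟨
    fromℤ (ℤ.- (i ℤ.* + suc n))       ≈⟨ neg-hom (i ℤ.* + suc n) ⟩
    - fromℤ (i ℤ.* + suc n)           ≈⟨ -‿cong (*-hom-pos i (suc n)) ⟩
    - (fromℤ i * fromℤ (+ suc n))     ≈⟨ -‿distribʳ-* _ _ ⟩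
    fromℤ i * fromℤ (-[1+ n ])        ∎

  homomorphism : ℤ.+-*-rawRing ACR.-Raw-AlmostCommutative⟶ ACR.fromCommutativeRing R
  homomorphism = record
    { ⟦_⟧ = fromℤ ; +-homo = +-hom ; *-homo = *-hom ; -‿homo = neg-hom
    ; 0-homo = refl ; 1-homo = refl }

  fromℤ-dec : ∀ i j → Maybe (fromℤ i ≈ fromℤ j)
  fromℤ-dec i j with i ℤ.≟ j
  ... | yes P.refl = just refl
  ... | no _       = nothing

  open import Algebra.Solver.Ring ℤ.+-*-rawRing (ACR.fromCommutativeRing R) homomorphism fromℤ-dec
    public

unique-↭ : ∀ {xs ys : List ℕ} → xs ↭ ys → Unique xs → Unique ys
unique-↭ p = ↭ₛ.Unique-resp-↭ (P.setoid ℕ) (↭⇒↭ₛ p)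

unique-drop₂ : ∀ {x y : ℕ} {ws} → Unique (x ∷ y ∷ ws) → Unique (x ∷ ws)
unique-drop₂ ((_ ∷ x∉ws) ∷ (_ ∷ ws!)) = x∉ws ∷ ws!

unique-drop₃ : ∀ {x y z : ℕ} {ws} → Unique (x ∷ y ∷ z ∷ ws) → Unique (x ∷ y ∷ ws)
unique-drop₃ ((x≢y ∷ _ ∷ x∉ws) ∷ ((_ ∷ y∉ws) ∷ (_ ∷ ws!))) = (x≢y ∷ x∉ws) ∷ (y∉ws ∷ ws!)

upTo-suc : ∀ n → upTo (suc n) ≡ 0 ∷ map suc (upTo n)
upTo-suc n = P.cong (0 ∷_) (P.sym (map-upTo suc n))

upTo-last : ∀ n → upTo (suc n) ↭ n ∷ upTo n
upTo-last n = ↭.↭-sym (P.subst (n ∷ upTo n ↭_) (upTo-∷ʳ n) (∷↭∷ʳ n (upTo n)))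

pull : ∀ {x : ℕ} {L} → x ∈ L → ∃ λ R → L ↭ x ∷ R
pull {x} x∈L with ys , zs , P.refl ← ∈-∃++ x∈L = ys ++ zs , shift x ys zs

unique-same-members-↭ : ∀ {xs ys : List ℕ} → Unique xs → Unique ys →
                        (∀ {z} → z ∈ xs → z ∈ ys) → (∀ {z} → z ∈ ys → z ∈ xs) → xs ↭ ys
unique-same-members-↭ xs! ys! ⊆ ⊇ = ∼bag⇒↭ (unique∧set⇒bag xs! ys! (mk⇔ ⊆ ⊇))

Bounded : ℕ → List ℕ → Set
Bounded n L = ∀ {u} → u ∈ L → u ℕ.≤ n

fresh-node-unique : ∀ {r} (a : Fin r → ℕ) → Injective _≡_ _≡_ a → ∀ x → (∀ i → a i ≢ x) →
                    Unique (x ∷ tabulate a)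
fresh-node-unique a a-inj x a≢x = AllP.tabulate⁺ (λ i x≡aᵢ → a≢x i (P.sym x≡aᵢ)) ∷ Unique.tabulate⁺ a-inj

earlier-nodes-unique : ∀ {r} (a : Fin r → ℕ) → Injective _≡_ _≡_ a → ∀ j →
                       Unique (a j ∷ tabulate (λ (i : Fin (toℕ j)) → a (inject i)))
earlier-nodes-unique a a-inj j =
  fresh-node-unique (λ i → a (inject i)) (λ e → inject-injective (a-inj e)) (a j)
    (λ i aᵢ≡aⱼ → j≢inject i (P.sym (a-inj aᵢ≡aⱼ)))
  where
  toℕ-inject : ∀ (i : Fin (toℕ j)) → toℕ (inject {i = j} i) ≡ toℕ i
  toℕ-inject = FinP.toℕ-inject
  inject-injective : ∀ {i i′ : Fin (toℕ j)} → inject {i = j} i ≡ inject i′ → i ≡ i′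
  inject-injective {i} {i′} e =
    FinP.toℕ-injective (P.trans (P.sym (toℕ-inject i)) (P.trans (P.cong toℕ e) (toℕ-inject i′)))
  j≢inject : ∀ (i : Fin (toℕ j)) → j ≢ inject i
  j≢inject i j≡i = ℕP.<-irrefl (P.sym (P.trans (P.cong toℕ j≡i) (toℕ-inject i))) (FinP.toℕ<n i)

module OrderedFieldFacts {c ℓ₁ ℓ₂ : Level} (F : OrderedField c ℓ₁ ℓ₂) where
  open OrderedField F
  open import Algebra.Properties.Ring ring using (-‿distribˡ-*; -‿distribʳ-*; -‿involutive)
  open import Algebra.Properties.Semiring.Mult semiring using (×-homo-+; ×1-homo-*) renaming (_×_ to _×ₙ_)
  open import Algebra.Properties.AbelianGroup +-abelianGroup using (xyx⁻¹≈y)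
  open import Relation.Binary.Reasoning.Setoid setoid
  open IsTotalOrder isTotalOrder public
    using (total; antisym; ≤-respʳ-≈; ≤-respˡ-≈) renaming (refl to ≤-refl; trans to ≤-trans)

  neg-nonneg : ∀ {x} → x ≤ 0# → 0# ≤ (- x)
  neg-nonneg {x} x≤0 = ≤-respˡ-≈ (-‿inverseʳ x) (≤-respʳ-≈ (+-identityˡ (- x)) (+-mono-≤ (- x) x≤0))

  +-nonneg : ∀ {x y} → 0# ≤ x → 0# ≤ y → 0# ≤ (x + y)
  +-nonneg {x} {y} 0≤x 0≤y = ≤-trans (≤-respʳ-≈ (sym (+-identityˡ y)) 0≤y) (+-mono-≤ y 0≤x)

  -- a square is nonnegative: x * x is also the square of - x
  square-nonneg : ∀ x → 0# ≤ (x * x)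
  square-nonneg x with total 0# x
  ... | inj₁ 0≤x = *-nonneg 0≤x 0≤x
  ... | inj₂ x≤0 = ≤-respʳ-≈ neg-square (*-nonneg (neg-nonneg x≤0) (neg-nonneg x≤0))
    where
    neg-square : - x * - x ≈ x * x
    neg-square = trans (sym (-‿distribˡ-* x (- x)))
                       (trans (-‿cong (sym (-‿distribʳ-* x x))) (-‿involutive _))

  -- 1# = 1# * 1# is a square
  0≤1 : 0# ≤ 1#
  0≤1 = ≤-respʳ-≈ (*-identityˡ 1#) (square-nonneg 1#)

  -- ι n is the n-fold sum of 1#, so the library's facts about multiples apply
  ι≡× : ∀ n → ι n ≡ n ×ₙ 1#
  ι≡× zero    = P.refl
  ι≡× (suc n) = P.cong (λ k → 1# + k) (ι≡× n)

  ι-+ : ∀ m n → ι (m ℕ.+ n) ≈ ι m + ι n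
  ι-+ m n rewrite ι≡× (m ℕ.+ n) | ι≡× m | ι≡× n = ×-homo-+ 1# m n

  ι-* : ∀ m n → ι (m ℕ.* n) ≈ ι m * ι n
  ι-* m n rewrite ι≡× (m ℕ.* n) | ι≡× m | ι≡× n = ×1-homo-* m n

  ι-nonneg : ∀ n → 0# ≤ ι n
  ι-nonneg zero    = ≤-refl
  ι-nonneg (suc n) = +-nonneg 0≤1 (ι-nonneg n)

  ι-∸ : ∀ {m n} → m ℕ.≤ n → ι n - ι m ≈ ι (n ℕ.∸ m)
  ι-∸ {m} {n} m≤n = begin
    ι n - ι m                      ≡⟨ P.cong (λ k → ι k - ι m) (ℕP.m+[n∸m]≡n m≤n) ⟨
    ι (m ℕ.+ (n ℕ.∸ m)) - ι m      ≈⟨ +-congʳ (ι-+ m (n ℕ.∸ m)) ⟩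
    ι m + ι (n ℕ.∸ m) - ι m        ≈⟨ xyx⁻¹≈y (ι m) (ι (n ℕ.∸ m)) ⟩
    ι (n ℕ.∸ m)                    ∎

  ¬1≤0 : ¬ (1# ≤ 0#)
  ¬1≤0 1≤0 = 0≉1 (antisym 0≤1 1≤0)

  ¬0≤-1 : ¬ (0# ≤ (- 1#))
  ¬0≤-1 0≤-1 = ¬1≤0 (≤-respˡ-≈ (+-identityˡ 1#) (≤-respʳ-≈ (-‿inverseˡ 1#) (+-mono-≤ 1# 0≤-1)))

  ι-suc≉0 : ∀ n → ¬ (ι (suc n) ≈ 0#)
  ι-suc≉0 n ι≈0 = ¬1≤0 (≤-respʳ-≈ ι≈0 1≤ι)
    where
    1≤ι : 1# ≤ ι (suc n)
    1≤ι = ≤-respˡ-≈ (+-identityˡ 1#) (≤-respʳ-≈ (+-comm _ _) (+-mono-≤ 1# (ι-nonneg n)))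

  inv-suc : ℕ → Carrier
  inv-suc n = proj₁ (inverse (ι (suc n)) (ι-suc≉0 n))

  inv-suc-spec : ∀ n → ι (suc n) * inv-suc n ≈ 1#
  inv-suc-spec n = proj₂ (inverse (ι (suc n)) (ι-suc≉0 n))

  inv-suc-nonneg : ∀ n → 0# ≤ inv-suc n
  inv-suc-nonneg n with total 0# (inv-suc n)
  ... | inj₁ 0≤inv = 0≤inv
  ... | inj₂ inv≤0 =
    ⊥-elim (¬0≤-1 (≤-respʳ-≈ neg-product (*-nonneg (ι-nonneg (suc n)) (neg-nonneg inv≤0))))
    where
    neg-product : ι (suc n) * - inv-suc n ≈ - 1#
    neg-product = trans (sym (-‿distribʳ-* _ _)) (-‿cong (inv-suc-spec n))

  ι-cancel-nonneg : ∀ {k x} → 1 ℕ.≤ k → 0# ≤ (ι k * x) → 0# ≤ x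
  ι-cancel-nonneg {suc k} {x} _ 0≤kx = ≤-respʳ-≈ x≈ (*-nonneg (inv-suc-nonneg k) 0≤kx)
    where
    x≈ : inv-suc k * (ι (suc k) * x) ≈ x
    x≈ = begin
      inv-suc k * (ι (suc k) * x)    ≈⟨ *-assoc _ _ _ ⟨
      (inv-suc k * ι (suc k)) * x    ≈⟨ *-congʳ (trans (*-comm _ _) (inv-suc-spec k)) ⟩
      1# * x                         ≈⟨ *-identityˡ x ⟩
      x                              ∎

  ι-∸-nonneg : ∀ {m n} → m ℕ.≤ n → 0# ≤ (ι n - ι m)
  ι-∸-nonneg {m} {n} m≤n = ≤-respʳ-≈ (sym (ι-∸ m≤n)) (ι-nonneg (n ℕ.∸ m))

  ι-∸-cancel-nonneg : ∀ {m n x} → m ℕ.< n → 0# ≤ ((ι n - ι m) * x) → 0# ≤ x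
  ι-∸-cancel-nonneg m<n 0≤dx =
    ι-cancel-nonneg (ℕP.m<n⇒0<n∸m m<n) (≤-respʳ-≈ (*-congʳ (ι-∸ (ℕP.<⇒≤ m<n))) 0≤dx)

module DividedDifferences {c ℓ₁ ℓ₂ : Level} (F : OrderedField c ℓ₁ ℓ₂) where
  open OrderedField F
  open OrderedFieldFacts F
  open IntegerCoefficients commutativeRing using (solve; _:=_; _:+_; _:*_; _:-_; :-_; con)
  open import Algebra.Properties.Ring ring using (-‿involutive; -0#≈0#)
  open import Relation.Binary.Reasoning.Setoid setoid

  -- ρ y u is 1/(y − u) for distinct naturals y, u.  The recursion makes
  -- ρ (suc y) (suc u) = ρ y u hold definitionally, so that translating all
  -- nodes by one does not change divided differences (sdd-shift below).
  ρ : ℕ → ℕ → Carrier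
  ρ zero    zero    = 0#
  ρ (suc y) zero    = inv-suc y
  ρ zero    (suc u) = - inv-suc u
  ρ (suc y) (suc u) = ρ y u

  ρ-spec : ∀ y u → y ≢ u → ρ y u * (ι y - ι u) ≈ 1#
  ρ-spec zero    zero    y≢u = ⊥-elim (y≢u P.refl)
  ρ-spec (suc y) zero    _   =
    trans (solve 2 (λ r a → r :* (a :- con (+ 0)) := a :* r) refl (inv-suc y) (ι (suc y))) (inv-suc-spec y)
  ρ-spec zero    (suc u) _   =
    trans (solve 2 (λ r a → (:- r) :* (con (+ 0) :- a) := a :* r) refl (inv-suc u) (ι (suc u))) (inv-suc-spec u)
  ρ-spec (suc y) (suc u) y≢u =
    trans (solve 3 (λ r a b → r :* ((con (+ 1) :+ a) :- (con (+ 1) :+ b)) := r :* (a :- b)) refl (ρ y u) (ι y) (ι u))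
          (ρ-spec y u (λ y≡u → y≢u (P.cong suc y≡u)))

  ρ-anti : ∀ y u → ρ u y ≈ - ρ y u
  ρ-anti zero    zero    = sym -0#≈0#
  ρ-anti (suc y) zero    = refl
  ρ-anti zero    (suc u) = sym (-‿involutive _)
  ρ-anti (suc y) (suc u) = ρ-anti y u

  -- One step of divided differences at the node y:
  --   δ y h u = (h u − h y)/(y − u) = − [y, u] h.
  δ : ℕ → (ℕ → Carrier) → ℕ → Carrier
  δ y h u = (h u - h y) * ρ y u

  δs : List ℕ → (ℕ → Carrier) → ℕ → Carrier
  δs []       h = h
  δs (y ∷ ys) h = δs ys (δ y h)

  -- The signed divided difference of h on the nodes x₀, …, x_k:
  --   sdd h [x₀, …, x_k] = (−1)^k [x₀, …, x_k] h.
  sdd : (ℕ → Carrier) → List ℕ → Carrier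
  sdd h []       = 0#
  sdd h (x ∷ ys) = δs ys h x

  δs-cong : ∀ ys {g g′ : ℕ → Carrier} x → (∀ u → u ∈ x ∷ ys → g u ≈ g′ u) → δs ys g x ≈ δs ys g′ x
  δs-cong []       x g≈g′ = g≈g′ x (here P.refl)
  δs-cong (y ∷ ys) x g≈g′ =
    δs-cong ys x (λ u u∈ → *-congʳ (+-cong (g≈g′ u (skip-y u∈)) (-‿cong (g≈g′ y (there (here P.refl))))))
    where
    skip-y : ∀ {u} → u ∈ x ∷ ys → u ∈ x ∷ y ∷ ys
    skip-y (here u≡x) = here u≡x
    skip-y (there u∈) = there (there u∈)

  partial-fractions : ∀ a b c Y Z U → a * (Y - U) ≈ 1# → b * (Y - Z) ≈ 1# → c * (Z - U) ≈ 1# →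
                      a * c - b * c + b * a ≈ 0#
  partial-fractions a b c Y Z U a≈ b≈ c≈ = begin
    a * c - b * c + b * a
      ≈⟨ solve 3 (λ ac bc ba → ac :- bc :+ ba := ac :* con (+ 1) :- bc :* con (+ 1) :+ ba :* con (+ 1))
                 refl (a * c) (b * c) (b * a) ⟩
    (a * c) * 1# - (b * c) * 1# + (b * a) * 1#
      ≈⟨ +-cong (+-cong (*-congˡ b≈) (-‿cong (*-congˡ a≈))) (*-congˡ c≈) ⟨
    (a * c) * (b * (Y - Z)) - (b * c) * (a * (Y - U)) + (b * a) * (c * (Z - U))
      ≈⟨ solve 6 (λ a b c Y Z U → (a :* c) :* (b :* (Y :- Z)) :- (b :* c) :* (a :* (Y :- U))
                                   :+ (b :* a) :* (c :* (Z :- U))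
                                   := con (+ 0))
                 refl a b c Y Z U ⟩
    0#
      ∎

  -- Two steps of divided differences commute (both sides equal [y, z, u] g):
  -- their difference is (g z − g y) times the partial-fraction expression.
  δ-comm : ∀ g y z u → u ≢ y → u ≢ z → y ≢ z → δ z (δ y g) u ≈ δ y (δ z g) u
  δ-comm g y z u u≢y u≢z y≢z = begin
    ((gu - gy) * a - (gz - gy) * b) * d
      ≈⟨ solve 6 (λ gu gy gz a b d → ((gu :- gy) :* a :- (gz :- gy) :* b) :* d
                   := ((gu :- gz) :* d :- (gy :- gz) :* (:- b)) :* a
                      :+ (gz :- gy) :* (a :* d :- b :* d :+ b :* a))
                 refl gu gy gz a b d ⟩
    ((gu - gz) * d - (gy - gz) * (- b)) * a + (gz - gy) * (a * d - b * d + b * a)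
      ≈⟨ +-cong (*-congʳ (+-congˡ (-‿cong (*-congˡ (sym (ρ-anti y z)))))) (*-congˡ pf) ⟩
    ((gu - gz) * d - (gy - gz) * ρ z y) * a + (gz - gy) * 0#
      ≈⟨ solve 2 (λ X e → X :+ e :* con (+ 0) := X) refl _ (gz - gy) ⟩
    ((gu - gz) * d - (gy - gz) * ρ z y) * a
      ∎
    where
    gu gy gz a b d : Carrier
    gu = g u
    gy = g y
    gz = g z
    a = ρ y u
    b = ρ y z
    d = ρ z u
    pf : a * d - b * d + b * a ≈ 0#
    pf = partial-fractions a b d (ι y) (ι z) (ι u) (ρ-spec y u (λ y≡u → u≢y (P.sym y≡u)))
           (ρ-spec y z y≢z) (ρ-spec z u (λ z≡u → u≢z (P.sym z≡u)))

  δs-swap : ∀ ws g x y z → Unique (x ∷ y ∷ z ∷ ws) → δs ws (δ z (δ y g)) x ≈ δs ws (δ y (δ z g)) x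
  δs-swap ws g x y z ((x≢y ∷ x≢z ∷ _) ∷ ((y≢z ∷ y∉ws) ∷ (z∉ws ∷ _))) = δs-cong ws x comm
    where
    comm : ∀ u → u ∈ x ∷ ws → δ z (δ y g) u ≈ δ y (δ z g) u
    comm u (here P.refl) = δ-comm g y z u x≢y x≢z y≢z
    comm u (there u∈ws)  = δ-comm g y z u (λ u≡y → All.lookup y∉ws u∈ws (P.sym u≡y))
                                          (λ u≡z → All.lookup z∉ws u∈ws (P.sym u≡z)) y≢z

  -- Peeling off the first node processed: the defining recurrence of
  -- divided differences, [x, y, ys] = ([x, ys] − [y, ys])/(x − y).
  δs-peel : ∀ ys g x y → Unique (x ∷ y ∷ ys) → δs (y ∷ ys) g x ≈ (δs ys g x - δs ys g y) * ρ y x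
  δs-peel []       g x y _ = refl
  δs-peel (z ∷ zs) g x y x∷y∷z∷zs! =
    trans (δs-swap zs g x y z x∷y∷z∷zs!) (δs-peel zs (δ z g) x y (unique-drop₃ x∷y∷z∷zs!))

  sdd-swap-head : ∀ ys g x y → Unique (x ∷ y ∷ ys) → δs (y ∷ ys) g x ≈ δs (x ∷ ys) g y
  sdd-swap-head ys g x y x∷y∷ys! = begin
    δs (y ∷ ys) g x                 ≈⟨ δs-peel ys g x y x∷y∷ys! ⟩
    (A - B) * ρ y x                 ≈⟨ solve 3 (λ A B r → (A :- B) :* r := (B :- A) :* (:- r)) refl A B (ρ y x) ⟩
    (B - A) * (- ρ y x)             ≈⟨ *-congˡ (ρ-anti y x) ⟨
    (B - A) * ρ x y                 ≈⟨ δs-peel ys g y x (unique-↭ (swap x y ↭.refl) x∷y∷ys!) ⟨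
    δs (x ∷ ys) g y                 ∎
    where
    A B : Carrier
    A = δs ys g x
    B = δs ys g y

  δs-perm : ∀ {ys ys′} x → ys ↭ ys′ → Unique (x ∷ ys) → ∀ g → δs ys g x ≈ δs ys′ g x
  δs-perm x ↭.refl          _   g = refl
  δs-perm x (prep y p)      x∷ys! g = δs-perm x p (unique-drop₂ x∷ys!) (δ y g)
  δs-perm x (swap y z p)    x∷ys! g =
    trans (δs-swap _ g x y z x∷ys!) (δs-perm x p (unique-drop₂ (unique-drop₂ x∷ys!)) (δ y (δ z g)))
  δs-perm x (↭.trans p q)   x∷ys! g =
    trans (δs-perm x p x∷ys! g) (δs-perm x q (unique-↭ (prep x p) x∷ys!) g)

  sdd-perm : ∀ {L L′} → L ↭ L′ → Unique L → ∀ h → sdd h L ≈ sdd h L′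
  sdd-perm ↭.refl        _  h = refl
  sdd-perm (prep x p)    L! h = δs-perm x p L! h
  sdd-perm (swap x y p)  L! h =
    trans (sdd-swap-head _ h x y L!) (δs-perm y (prep x p) (unique-↭ (swap x y ↭.refl) L!) h)
  sdd-perm (↭.trans p q) L! h = trans (sdd-perm p L! h) (sdd-perm q (unique-↭ p L!) h)

  δs-shift : ∀ ys h x → δs (map suc ys) h (suc x) ≡ δs ys (λ u → h (suc u)) x
  δs-shift []       h x = P.refl
  δs-shift (y ∷ ys) h x = δs-shift ys (δ (suc y) h) x

  sdd-shift : ∀ L h → sdd h (map suc L) ≡ sdd (λ u → h (suc u)) L
  sdd-shift []       h = P.refl
  sdd-shift (x ∷ ys) h = δs-shift ys h x

  sdd-step : ∀ ys h x y → Unique (x ∷ y ∷ ys) →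
             (ι y - ι x) * sdd h (x ∷ y ∷ ys) ≈ sdd h (x ∷ ys) - sdd h (y ∷ ys)
  sdd-step ys h x y x∷y∷ys!@((x≢y ∷ _) ∷ _) = begin
    (ι y - ι x) * δs (y ∷ ys) h x   ≈⟨ *-congˡ (δs-peel ys h x y x∷y∷ys!) ⟩
    (ι y - ι x) * ((A - B) * ρ y x) ≈⟨ solve 4 (λ d A B r → d :* ((A :- B) :* r) := (A :- B) :* (r :* d))
                                             refl (ι y - ι x) A B (ρ y x) ⟩
    (A - B) * (ρ y x * (ι y - ι x)) ≈⟨ *-congˡ (ρ-spec y x (λ y≡x → x≢y (P.sym y≡x))) ⟩
    (A - B) * 1#                    ≈⟨ *-identityʳ _ ⟩
    A - B                           ∎
    where
    A B : Carrier
    A = δs ys h x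
    B = δs ys h y

  -- Inserting a node: for distinct m, x, y the divided difference on
  -- x, y, R is a combination of those on x, m, R and y, m, R,
  --   (y − x)·sdd(x,y,R) = (m − x)·sdd(x,m,R) + (y − m)·sdd(y,m,R),
  -- a convex combination when x < m < y.
  sdd-insert : ∀ h m x y R → Unique (m ∷ x ∷ y ∷ R) →
               (ι y - ι x) * sdd h (x ∷ y ∷ R)
                 ≈ (ι m - ι x) * sdd h (x ∷ m ∷ R) + (ι y - ι m) * sdd h (y ∷ m ∷ R)
  sdd-insert h m x y R m∷x∷y∷R! = begin
    (Y - X) * C
      ≈⟨ *-congˡ C≈ ⟩
    (Y - X) * (B + (M - X) * D)
      ≈⟨ solve 5 (λ Y X M B D → (Y :- X) :* (B :+ (M :- X) :* D) := (Y :- X) :* B :+ (M :- X) :* ((Y :- X) :* D))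
                 refl Y X M B D ⟩
    (Y - X) * B + (M - X) * ((Y - X) * D)
      ≈⟨ +-congˡ (*-congˡ e₁) ⟩
    (Y - X) * B + (M - X) * (A - B)
      ≈⟨ solve 5 (λ Y X M A B → (Y :- X) :* B :+ (M :- X) :* (A :- B) := (M :- X) :* A :+ (Y :- M) :* B)
                 refl Y X M A B ⟩
    (M - X) * A + (Y - M) * B
      ∎
    where
    -- D is the divided difference on all of x, y, m, R; e₁ and e₂ are the
    -- recurrence applied to it after removing m resp. y
    X Y M A B C D : Carrier
    X = ι x
    Y = ι y
    M = ι m
    A = sdd h (x ∷ m ∷ R)
    B = sdd h (y ∷ m ∷ R)
    C = sdd h (x ∷ y ∷ R)
    D = sdd h (x ∷ y ∷ m ∷ R)
    x∷m∷y∷R! : Unique (x ∷ m ∷ y ∷ R)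
    x∷m∷y∷R! = unique-↭ (swap m x ↭.refl) m∷x∷y∷R!
    m∷y∷R! : Unique (m ∷ y ∷ R)
    m∷y∷R! = unique-drop₂ m∷x∷y∷R!
    x∷y∷m∷R↭ : x ∷ m ∷ y ∷ R ↭ x ∷ y ∷ m ∷ R
    x∷y∷m∷R↭ = prep x (swap m y ↭.refl)
    e₁ : (Y - X) * D ≈ A - B
    e₁ = sdd-step (m ∷ R) h x y (unique-↭ x∷y∷m∷R↭ x∷m∷y∷R!)
    e₂ : (M - X) * D ≈ C - B
    e₂ = begin
      (M - X) * D                     ≈⟨ *-congˡ (sdd-perm x∷y∷m∷R↭ x∷m∷y∷R! h) ⟨
      (M - X) * sdd h (x ∷ m ∷ y ∷ R) ≈⟨ sdd-step (y ∷ R) h x m x∷m∷y∷R! ⟩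
      C - sdd h (m ∷ y ∷ R)           ≈⟨ +-congˡ (-‿cong (sdd-perm (swap m y ↭.refl) m∷y∷R! h)) ⟩
      C - B                           ∎
    C≈ : C ≈ B + (M - X) * D
    C≈ = trans (solve 2 (λ C B → C := B :+ (C :- B)) refl C B) (+-congˡ (sym e₂))

  Δ^-shift : ∀ k h i → Δ^ k (λ u → h (suc u)) i ≡ Δ^ k h (suc i)
  Δ^-shift zero    h i = P.refl
  Δ^-shift (suc k) h i = P.cong₂ _-_ (Δ^-shift k h (suc i)) (Δ^-shift k h i)

  sdd-upTo : ∀ n h → ι (n !) * sdd h (upTo (suc n)) ≈ sgn n * Δ^ n h 0
  sdd-upTo zero    h = *-congʳ (+-identityʳ 1#)
  sdd-upTo (suc n) h = begin
    ι (N !) * sdd h (upTo (suc N))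
      ≈⟨ *-cong (ι-* N (n !)) (sdd-perm nodes↭ (Unique.upTo⁺ (suc N)) h) ⟩
    (ι N * ι (n !)) * C
      ≈⟨ solve 3 (λ a b C → (a :* b) :* C := b :* (a :* C)) refl (ι N) (ι (n !)) C ⟩
    ι (n !) * (ι N * C)
      ≈⟨ *-congˡ (*-congʳ (ι-∸ {0} {N} ℕ.z≤n)) ⟨
    ι (n !) * ((ι N - ι 0) * C)
      ≈⟨ *-congˡ (sdd-step mid h 0 N (unique-↭ nodes↭ (Unique.upTo⁺ (suc N)))) ⟩
    ι (n !) * (sdd h (0 ∷ mid) - sdd h (N ∷ mid))
      ≡⟨ P.cong (λ L → ι (n !) * (sdd h L - sdd h (N ∷ mid))) (upTo-suc n) ⟨
    ι (n !) * (sdd h (upTo N) - sdd h (N ∷ mid))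
      ≈⟨ *-congˡ (+-congˡ (-‿cong last)) ⟩
    ι (n !) * (sdd h (upTo N) - sdd h′ (upTo N))
      ≈⟨ solve 3 (λ a P Q → a :* (P :- Q) := a :* P :- a :* Q) refl (ι (n !)) _ _ ⟩
    ι (n !) * sdd h (upTo N) - ι (n !) * sdd h′ (upTo N)
      ≈⟨ +-cong (sdd-upTo n h) (-‿cong (sdd-upTo n h′)) ⟩
    sgn n * Δ^ n h 0 - sgn n * Δ^ n h′ 0
      ≡⟨ P.cong (λ v → sgn n * Δ^ n h 0 - sgn n * v) (Δ^-shift n h 0) ⟩
    sgn n * Δ^ n h 0 - sgn n * Δ^ n h 1
      ≈⟨ solve 3 (λ s a b → s :* a :- s :* b := (:- s) :* (b :- a)) refl (sgn n) _ _ ⟩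
    sgn (suc n) * Δ^ (suc n) h 0
      ∎
    where
    N : ℕ
    N = suc n
    mid : List ℕ
    mid = map suc (upTo n)
    h′ : ℕ → Carrier
    h′ u = h (suc u)
    C : Carrier
    C = sdd h (0 ∷ N ∷ mid)
    -- the nodes 0, …, N rearranged as 0, N, 1, …, n, so that the recurrence
    -- splits off the nodes 1, …, N (a translate of 0, …, n) and 0, …, n
    nodes↭ : upTo (suc N) ↭ 0 ∷ N ∷ mid
    nodes↭ = P.subst (_↭ 0 ∷ N ∷ mid) (P.sym (upTo-suc N)) (prep 0 (map⁺ suc (upTo-last n)))
    last : sdd h (N ∷ mid) ≈ sdd h′ (upTo N)
    last = trans (reflexive (sdd-shift (n ∷ upTo n) h))
                 (sdd-perm (↭.↭-sym (upTo-last n)) (unique-↭ (upTo-last n) (Unique.upTo⁺ N)) h′)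

module CompleteMonotonicity {c ℓ₁ ℓ₂ : Level} (F : OrderedField c ℓ₁ ℓ₂) where
  open OrderedField F
  open OrderedFieldFacts F
  open DividedDifferences F

  -- h : ℕ → F is completely monotonic on {0, …, n}; CompletelyMonotonic f
  -- is by definition CM n (extend f).
  CM : ℕ → (ℕ → Carrier) → Set ℓ₂
  CM n h = ∀ (k i : ℕ) → i ℕ.+ k ℕ.≤ n → 0# ≤ (sgn k * Δ^ k h i)

  extend-toℕ : ∀ {n} (f : Fin (suc n) → Carrier) (x : Fin (suc n)) → extend f (toℕ x) ≡ f x
  extend-toℕ {n} f x with toℕ x ℕ.<? suc n
  ... | yes x<n = P.cong f (FinP.fromℕ<-toℕ x x<n)
  ... | no  x≮n = ⊥-elim (x≮n (FinP.toℕ<n x))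

  CM-shift : ∀ {n h} → CM (suc n) h → CM n (λ u → h (suc u))
  CM-shift {n} {h} cm k i i+k≤n =
    P.subst (λ v → 0# ≤ (sgn k * v)) (P.sym (Δ^-shift k h i)) (cm k (suc i) (ℕ.s≤s i+k≤n))

  CM-weaken : ∀ {n h} → CM (suc n) h → CM n h
  CM-weaken cm k i i+k≤n = cm k i (ℕP.m≤n⇒m≤1+n i+k≤n)

  CM-nonneg : ∀ {n h x} → CM n h → x ℕ.≤ n → 0# ≤ h x
  CM-nonneg {n} {h} {x} cm x≤n =
    ≤-respʳ-≈ (*-identityˡ (h x)) (cm 0 x (P.subst (ℕ._≤ n) (P.sym (ℕP.+-identityʳ x)) x≤n))

  SignProperty : ℕ → Set (c ⊔ ℓ₂)
  SignProperty n = ∀ h → CM n h → ∀ L → Unique L → Bounded n L → 0# ≤ sdd h L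

  -- Nodes avoiding 0 are translates of nodes in {0, …, n}.
  via-shift : ∀ {n} → SignProperty n → ∀ h → CM (suc n) h → ∀ L → Unique L → Bounded (suc n) L → 0 ∉ L →
              0# ≤ sdd h L
  via-shift {n} sign h cm L L! bd 0∉L =
    P.subst (λ K → 0# ≤ sdd h K) (P.sym L≡)
      (P.subst (0# ≤_) (P.sym (sdd-shift L′ h)) (sign (λ u → h (suc u)) (CM-shift cm) L′ L′! bd′))
    where
    L′ : List ℕ
    L′ = map ℕ.pred L
    L≡ : L ≡ map suc L′
    L≡ = P.sym (P.trans (P.sym (map-∘ L)) (map-id-local (All.tabulate suc-pred≡)))
      where
      suc-pred≡ : ∀ {u} → u ∈ L → suc (ℕ.pred u) ≡ u
      suc-pred≡ {zero}  0∈L = ⊥-elim (0∉L 0∈L)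
      suc-pred≡ {suc u} _   = P.refl
    L′! : Unique L′
    L′! = Unique.map⁻ (P.subst Unique L≡ L!)
    bd′ : Bounded n L′
    bd′ v∈ with _ , w∈ , P.refl ← ∈-map⁻ ℕ.pred v∈ = ℕP.pred-mono-≤ (bd w∈)

  via-weaken : ∀ {n} → SignProperty n → ∀ h → CM (suc n) h → ∀ L → Unique L → Bounded (suc n) L → suc n ∉ L →
               0# ≤ sdd h L
  via-weaken sign h cm L L! bd N∉L =
    sign h (CM-weaken cm) L L! (λ v∈ → ℕ.s≤s⁻¹ (ℕP.≤∧≢⇒< (bd v∈) (λ v≡N → N∉L (P.subst (_∈ L) v≡N v∈))))

  sign-full : ∀ n h → CM n h → ∀ L → Unique L → Bounded n L → (∀ (i : Fin (suc n)) → toℕ i ∈ L) →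
              0# ≤ sdd h L
  sign-full n h cm L L! bd full = ι-cancel-nonneg (ℕP.1≤n! n) (≤-respʳ-≈ Δ≈ (cm n 0 ℕP.≤-refl))
    where
    L↭ : L ↭ upTo (suc n)
    L↭ = unique-same-members-↭ L! (Unique.upTo⁺ (suc n)) (λ u∈ → ∈-upTo⁺ (ℕ.s≤s (bd u∈)))
           (λ z∈ → P.subst (_∈ L) (FinP.toℕ-fromℕ< (∈-upTo⁻ z∈)) (full (Fin.fromℕ< (∈-upTo⁻ z∈))))
    Δ≈ : sgn n * Δ^ n h 0 ≈ ι (n !) * sdd h L
    Δ≈ = trans (sym (sdd-upTo n h)) (*-congˡ (sdd-perm (↭-sym L↭) (Unique.upTo⁺ (suc n)) h))

  -- When 0 and N = suc n are nodes but m is not, sdd-insert gives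
  --   N · sdd h (0, N, R) = m · sdd h (0, m, R) + (N − m) · sdd h (N, m, R),
  -- where the nodes on the right avoid N resp. 0, so the induction hypothesis applies.
  sign-insert : ∀ {n} → SignProperty n → ∀ h → CM (suc n) h → ∀ m R →
                Unique (m ∷ 0 ∷ suc n ∷ R) → Bounded (suc n) (m ∷ 0 ∷ suc n ∷ R) → 0# ≤ sdd h (0 ∷ suc n ∷ R)
  sign-insert {n} sign h cm m R K! bd =
    ι-∸-cancel-nonneg {0} {N} (ℕ.s≤s ℕ.z≤n) (≤-respʳ-≈ (sym (sdd-insert h m 0 N R K!))
      (+-nonneg (*-nonneg (ι-∸-nonneg {0} {m} ℕ.z≤n) A≥0)
                (*-nonneg (ι-∸-nonneg (bd (here P.refl))) B≥0)))
    where
    N : ℕ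
    N = suc n
    0Nm↭ : m ∷ 0 ∷ N ∷ R ↭ 0 ∷ N ∷ m ∷ R
    0Nm↭ = ↭.trans (swap m 0 ↭.refl) (prep 0 (swap m N ↭.refl))
    N0m↭ : m ∷ 0 ∷ N ∷ R ↭ N ∷ 0 ∷ m ∷ R
    N0m↭ = ↭.trans 0Nm↭ (swap 0 N ↭.refl)
    A≥0 : 0# ≤ sdd h (0 ∷ m ∷ R)
    A≥0 with N0m! ← unique-↭ N0m↭ K! = via-weaken sign h cm _ (Unique.drop⁺ 1 N0m!)
      (λ u∈ → bd (∈-resp-↭ (↭-sym N0m↭) (there u∈))) (Unique.Unique[x∷xs]⇒x∉xs N0m!)
    B≥0 : 0# ≤ sdd h (N ∷ m ∷ R)
    B≥0 with 0Nm! ← unique-↭ 0Nm↭ K! = via-shift sign h cm _ (Unique.drop⁺ 1 0Nm!)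
      (λ u∈ → bd (∈-resp-↭ (↭-sym 0Nm↭) (there u∈))) (Unique.Unique[x∷xs]⇒x∉xs 0Nm!)

  sign-gap : ∀ {n} → SignProperty n → ∀ h → CM (suc n) h → ∀ L → Unique L → Bounded (suc n) L →
             0 ∈ L → suc n ∈ L → ∀ m → m ℕ.≤ suc n → m ∉ L → 0# ≤ sdd h L
  sign-gap {n} sign h cm L L! bd 0∈L N∈L m m≤N m∉L
    with R₁ , L↭0R₁ ← pull 0∈L
    with there N∈R₁ ← ∈-resp-↭ L↭0R₁ N∈L
    with R , R₁↭NR ← pull N∈R₁ =
    ≤-respʳ-≈ (sym (sdd-perm L↭ L! h))
      (sign-insert sign h cm m R (All-resp-↭ L↭ (AllP.¬Any⇒All¬ L m∉L) ∷ unique-↭ L↭ L!)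
        (λ { (here P.refl) → m≤N ; (there u∈) → bd (∈-resp-↭ (↭-sym L↭) u∈) }))
    where
    L↭ : L ↭ 0 ∷ suc n ∷ R
    L↭ = ↭.trans L↭0R₁ (prep 0 R₁↭NR)

  sdd-nonneg : ∀ n → SignProperty n
  sdd-nonneg zero h cm []          _               _  = ≤-refl
  sdd-nonneg zero h cm (x ∷ [])    _               bd = CM-nonneg cm (bd (here P.refl))
  sdd-nonneg zero h cm (x ∷ y ∷ _) ((x≢y ∷ _) ∷ _) bd =
    ⊥-elim (x≢y (P.trans (ℕP.n≤0⇒n≡0 (bd (here P.refl))) (P.sym (ℕP.n≤0⇒n≡0 (bd (there (here P.refl)))))))
  sdd-nonneg (suc n) h cm L L! bd
    with 0 ∈? L | suc n ∈? L | FinP.all? (λ (i : Fin (suc (suc n))) → toℕ i ∈? L)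
  ... | no 0∉L  | _       | _        = via-shift (sdd-nonneg n) h cm L L! bd 0∉L
  ... | yes _   | no N∉L  | _        = via-weaken (sdd-nonneg n) h cm L L! bd N∉L
  ... | yes _   | yes _   | yes full = sign-full (suc n) h cm L L! bd full
  ... | yes 0∈L | yes N∈L | no ¬full
    with i , i∉L ← FinP.¬∀⟶∃¬ _ _ (λ i → toℕ i ∈? L) ¬full =
    sign-gap (sdd-nonneg n) h cm L L! bd 0∈L N∈L (toℕ i) (ℕ.s≤s⁻¹ (FinP.toℕ<n i)) i∉L

module Interpolation {c ℓ₁ ℓ₂ : Level} (F : OrderedField c ℓ₁ ℓ₂) where
  open OrderedField F
  open OrderedFieldFacts F
  open DividedDifferences F
  open CompleteMonotonicity F
  open IntegerCoefficients commutativeRing using (solve; _:=_; _:+_; _:*_; _:-_; :-_; con)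
  open import Relation.Binary.Reasoning.Setoid setoid

  newton : ∀ {r} → Vec Carrier r → (Fin r → Carrier) → Carrier → Carrier
  newton []       α x = 0#
  newton (c ∷ cs) α x = c + (α Fin.zero - x) * newton cs (λ i → α (Fin.suc i)) x

  divide-linear : ∀ {m} (p : Vec Carrier (suc m)) y →
                  Σ (Vec Carrier m) (λ q → ∀ x → eval p x ≈ eval p y + (y - x) * eval q x)
  divide-linear {zero}  (c ∷ []) y = [] , λ x →
    solve 3 (λ c x y → c :+ x :* con (+ 0) := (c :+ y :* con (+ 0)) :+ (y :- x) :* con (+ 0)) refl c x y
  divide-linear {suc m} (c ∷ p) y with q , p≈ ← divide-linear p y = (- eval p y) ∷ q , λ x → begin
    c + x * eval p x
      ≈⟨ +-congˡ (*-congˡ (p≈ x)) ⟩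
    c + x * (eval p y + (y - x) * eval q x)
      ≈⟨ solve 5 (λ c x y py qx → c :+ x :* (py :+ (y :- x) :* qx)
                                  := (c :+ y :* py) :+ (y :- x) :* ((:- py) :+ x :* qx))
                 refl c x y (eval p y) (eval q x) ⟩
    (c + y * eval p y) + (y - x) * (- eval p y + x * eval q x)
      ∎

  newton-form : ∀ {r} (p : Vec Carrier r) (α : Fin r → Carrier) →
                Σ (Vec Carrier r) (λ cs → ∀ x → eval p x ≈ newton cs α x)
  newton-form []        α = [] , λ x → refl
  newton-form p@(_ ∷ _) α
    with q , p≈ ← divide-linear p (α Fin.zero)
    with cs , q≈ ← newton-form q (λ i → α (Fin.suc i)) =
    eval p (α Fin.zero) ∷ cs , λ x → trans (p≈ x) (+-congˡ (*-congˡ (q≈ x)))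

  Σ-cong : ∀ {m} {g g′ : Fin m → Carrier} → (∀ j → g j ≈ g′ j) → Σ[ g ] ≈ Σ[ g′ ]
  Σ-cong {zero}  g≈g′ = refl
  Σ-cong {suc m} g≈g′ = +-cong (g≈g′ Fin.zero) (Σ-cong (λ j → g≈g′ (Fin.suc j)))

  Σ-distribˡ : ∀ {m} (g : Fin m → Carrier) d → Σ[ (λ j → d * g j) ] ≈ d * Σ[ g ]
  Σ-distribˡ {zero}  g d = sym (zeroʳ d)
  Σ-distribˡ {suc m} g d = trans (+-congˡ (Σ-distribˡ (λ j → g (Fin.suc j)) d)) (sym (distribˡ d _ _))

  newton-expanded : ∀ {r} (cs : Vec Carrier r) (α : Fin r → Carrier) x →
    newton cs α x ≈ Σ[ (λ (j : Fin r) → lookup cs j * Π[ (λ (i : Fin (toℕ j)) → α (inject i) - x) ]) ]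
  newton-expanded []       α x = refl
  newton-expanded (c ∷ cs) α x = +-cong (sym (*-identityʳ c)) (begin
    d * newton cs α′ x                  ≈⟨ *-congˡ (newton-expanded cs α′ x) ⟩
    d * Σ[ (λ j → cⱼ j * Πⱼ j) ]        ≈⟨ Σ-distribˡ (λ j → cⱼ j * Πⱼ j) d ⟨
    Σ[ (λ j → d * (cⱼ j * Πⱼ j)) ]      ≈⟨ Σ-cong (λ j → solve 3 (λ d a b → d :* (a :* b) := a :* (d :* b))
                                                             refl d (cⱼ j) (Πⱼ j)) ⟩
    Σ[ (λ j → cⱼ j * (d * Πⱼ j)) ]      ∎)
    where
    d : Carrier
    d = α Fin.zero - x
    α′ : Fin _ → Carrier
    α′ i = α (Fin.suc i)
    cⱼ Πⱼ : Fin _ → Carrier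
    cⱼ j = lookup cs j
    Πⱼ j = Π[ (λ (i : Fin (toℕ j)) → α′ (inject i) - x) ]

  Interpolates : ∀ {r} → Vec Carrier r → (Fin r → ℕ) → (ℕ → Carrier) → Set ℓ₁
  Interpolates cs a h = ∀ i → newton cs (λ k → ι (a k)) (ι (a i)) ≈ h (a i)

  interpolates-head : ∀ {r} c (cs : Vec Carrier r) a h → Interpolates (c ∷ cs) a h → c ≈ h (a Fin.zero)
  interpolates-head c cs a h interp =
    trans (solve 3 (λ c y N → c := c :+ (y :- y) :* N) refl c (ι (a Fin.zero)) _) (interp Fin.zero)

  interpolates-tail : ∀ {r} c (cs : Vec Carrier r) a h → Injective _≡_ _≡_ a → Interpolates (c ∷ cs) a h →
                      Interpolates cs (λ i → a (Fin.suc i)) (δ (a Fin.zero) h)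
  interpolates-tail c cs a h a-inj interp i = begin
    N                     ≈⟨ *-identityʳ N ⟨
    N * 1#                ≈⟨ *-congˡ (ρ-spec (a Fin.zero) (a (Fin.suc i)) (λ a₀≡aᵢ → 0≢suc (a-inj a₀≡aᵢ))) ⟨
    N * (r * d)           ≈⟨ solve 4 (λ c N d r → N :* (r :* d) := ((c :+ d :* N) :- c) :* r) refl c N d r ⟩
    ((c + d * N) - c) * r ≈⟨ *-congʳ (+-cong (interp (Fin.suc i)) (-‿cong (interpolates-head c cs a h interp))) ⟩
    (h (a (Fin.suc i)) - h (a Fin.zero)) * r ∎
    where
    N d r : Carrier
    N = newton cs (λ k → ι (a (Fin.suc k))) (ι (a (Fin.suc i)))
    d = ι (a Fin.zero) - ι (a (Fin.suc i))
    r = ρ (a Fin.zero) (a (Fin.suc i))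
    0≢suc : Fin.zero ≢ Fin.suc i
    0≢suc ()

  interpolation-error : ∀ {r} (cs : Vec Carrier r) a h → Injective _≡_ _≡_ a → Interpolates cs a h →
    ∀ x → (∀ i → a i ≢ x) →
    h x - newton cs (λ k → ι (a k)) (ι x) ≈ Π[ (λ i → ι (a i) - ι x) ] * sdd h (x ∷ tabulate a)
  interpolation-error []       a h _     _      x _   =
    solve 1 (λ hx → hx :- con (+ 0) := con (+ 1) :* hx) refl (h x)
  interpolation-error (c ∷ cs) a h a-inj interp x a≢x = begin
    h x - (c + d * N)
      ≈⟨ +-congˡ (-‿cong (+-congʳ (interpolates-head c cs a h interp))) ⟩
    h x - (h₀ + d * N)
      ≈⟨ solve 4 (λ hx h₀ d N → hx :- (h₀ :+ d :* N) := (hx :- h₀) :* con (+ 1) :- d :* N) refl (h x) h₀ d N ⟩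
    (h x - h₀) * 1# - d * N
      ≈⟨ +-congʳ (*-congˡ (ρ-spec (a Fin.zero) x (a≢x Fin.zero))) ⟨
    (h x - h₀) * (r * d) - d * N
      ≈⟨ solve 5 (λ hx h₀ d N r → (hx :- h₀) :* (r :* d) :- d :* N := d :* ((hx :- h₀) :* r :- N))
                 refl (h x) h₀ d N r ⟩
    d * (δ (a Fin.zero) h x - N)
      ≈⟨ *-congˡ error-tail ⟩
    d * (Π[ factors ] * E)
      ≈⟨ *-assoc d _ E ⟨
    (d * Π[ factors ]) * E
      ∎
    where
    a′ : Fin _ → ℕ
    a′ i = a (Fin.suc i)
    factors : Fin _ → Carrier
    factors i = ι (a′ i) - ι x
    h₀ d r N E : Carrier
    h₀ = h (a Fin.zero)
    d = ι (a Fin.zero) - ι x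
    r = ρ (a Fin.zero) x
    N = newton cs (λ k → ι (a′ k)) (ι x)
    E = sdd (δ (a Fin.zero) h) (x ∷ tabulate a′)
    error-tail : δ (a Fin.zero) h x - N ≈ Π[ factors ] * E
    error-tail = interpolation-error cs a′ (δ (a Fin.zero) h) (λ e → FinP.suc-injective (a-inj e))
                   (interpolates-tail c cs a h a-inj interp) x (λ i → a≢x (Fin.suc i))

  newton-coefficient : ∀ {r} (cs : Vec Carrier r) a h → Injective _≡_ _≡_ a → Interpolates cs a h → ∀ j →
    lookup cs j ≈ sdd h (a j ∷ tabulate (λ (i : Fin (toℕ j)) → a (inject i)))
  newton-coefficient (c ∷ cs) a h a-inj interp Fin.zero    = interpolates-head c cs a h interp
  newton-coefficient (c ∷ cs) a h a-inj interp (Fin.suc j) =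
    newton-coefficient cs (λ i → a (Fin.suc i)) (δ (a Fin.zero) h) (λ e → FinP.suc-injective (a-inj e))
      (interpolates-tail c cs a h a-inj interp) j

  Π-zero : ∀ {m} (g : Fin m → Carrier) i → g i ≈ 0# → Π[ g ] ≈ 0#
  Π-zero g Fin.zero    gᵢ≈0 = trans (*-congʳ gᵢ≈0) (zeroˡ _)
  Π-zero g (Fin.suc i) gᵢ≈0 = trans (*-congˡ (Π-zero (λ k → g (Fin.suc k)) i gᵢ≈0)) (zeroʳ _)

  -- First conclusion: for h completely monotonic on {0, …, n} and an
  -- interpolant at distinct nodes in {0, …, n}, (h(x) − p(x)) Π (a_i − x) ≥ 0:
  -- it vanishes at the nodes, and elsewhere equals Π² · sdd h (x, a₀, …).
  error-sign : ∀ {n r} h → CM n h → (cs : Vec Carrier r) (a : Fin r → ℕ) → Injective _≡_ _≡_ a →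
    (∀ i → a i ℕ.≤ n) → Interpolates cs a h → ∀ x → x ℕ.≤ n →
    0# ≤ ((h x - newton cs (λ k → ι (a k)) (ι x)) * Π[ (λ i → ι (a i) - ι x) ])
  error-sign {n} h cm cs a a-inj a≤n interp x x≤n with FinP.any? (λ i → a i ℕP.≟ x)
  ... | yes (i , aᵢ≡x) = ≤-respʳ-≈ (sym (trans (*-congˡ (Π-zero factors i factorᵢ≈0)) (zeroʳ _))) ≤-refl
    where
    factors : Fin _ → Carrier
    factors k = ι (a k) - ι x
    factorᵢ≈0 : factors i ≈ 0#
    factorᵢ≈0 = P.subst (λ v → ι v - ι x ≈ 0#) (P.sym aᵢ≡x) (-‿inverseʳ (ι x))
  ... | no x∉a =
    ≤-respʳ-≈ (sym error≈) (*-nonneg (square-nonneg Π′) (sdd-nonneg n h cm (x ∷ tabulate a) nodes! nodes≤n))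
    where
    Π′ E : Carrier
    Π′ = Π[ (λ i → ι (a i) - ι x) ]
    E = sdd h (x ∷ tabulate a)
    error≈ : (h x - newton cs (λ k → ι (a k)) (ι x)) * Π′ ≈ (Π′ * Π′) * E
    error≈ = trans (*-congʳ (interpolation-error cs a h a-inj interp x (λ i aᵢ≡x → x∉a (i , aᵢ≡x))))
                   (solve 2 (λ P E → (P :* E) :* P := (P :* P) :* E) refl Π′ E)
    nodes! : Unique (x ∷ tabulate a)
    nodes! = fresh-node-unique a a-inj x (λ i aᵢ≡x → x∉a (i , aᵢ≡x))
    nodes≤n : Bounded n (x ∷ tabulate a)
    nodes≤n (here P.refl) = x≤n
    nodes≤n (there u∈) with i , P.refl ← ∈-tabulate⁻ u∈ = a≤n i

  coefficients-nonneg : ∀ {n r} h → CM n h → (cs : Vec Carrier r) (a : Fin r → ℕ) → Injective _≡_ _≡_ a →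
    (∀ i → a i ℕ.≤ n) → Interpolates cs a h → ∀ j → 0# ≤ lookup cs j
  coefficients-nonneg {n} h cm cs a a-inj a≤n interp j =
    ≤-respʳ-≈ (sym (newton-coefficient cs a h a-inj interp j))
      (sdd-nonneg n h cm _ (earlier-nodes-unique a a-inj j) nodes≤n)
    where
    nodes≤n : Bounded n (a j ∷ tabulate (λ (i : Fin (toℕ j)) → a (inject i)))
    nodes≤n (here P.refl) = a≤n j
    nodes≤n (there u∈) with i , P.refl ← ∈-tabulate⁻ u∈ = a≤n (inject i)

lemma4p9 : ∀ {c ℓ₁ ℓ₂ : Level} (F : OrderedField c ℓ₁ ℓ₂) → let open OrderedField F in
    (n : ℕ) (f : Fin (suc n) → Carrier) → CompletelyMonotonic f →
    (r : ℕ) → 1 ≤ℕ r → (a : Fin r → Fin (suc n)) → Injective _≡_ _≡_ a →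
    (p : Vec Carrier r) → (∀ i → eval p (ι (toℕ (a i))) ≈ f (a i)) →
    ((x : Fin (suc n)) →
       0# ≤ ((f x ∸F eval p (ι (toℕ x))) * Π[ (λ i → ι (toℕ (a i)) ∸F ι (toℕ x)) ]))
    × Σ (Vec Carrier r) (λ cs →
        (∀ j → 0# ≤ lookup cs j)
        × (∀ (x : Carrier) →
             eval p x ≈ Σ[ (λ (j : Fin r) → lookup cs j * Π[ (λ (i : Fin (toℕ j)) → ι (toℕ (a (inject i))) ∸F x) ]) ]))
lemma4p9 F n f cm r _ a a-inj p p-interp =
  error-sign′ , cs , coefficients-nonneg h cm cs nodes nodes-inj nodes≤n interp ,
  λ x → trans (p≈cs x) (newton-expanded cs α x)
  where
  open OrderedField F
  open OrderedFieldFacts F using (≤-respʳ-≈)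
  open CompleteMonotonicity F using (extend-toℕ)
  open Interpolation F
  h : ℕ → Carrier
  h = extend f
  nodes : Fin r → ℕ
  nodes i = toℕ (a i)
  α : Fin r → Carrier
  α i = ι (nodes i)
  nodes-inj : Injective _≡_ _≡_ nodes
  nodes-inj e = a-inj (FinP.toℕ-injective e)
  nodes≤n : ∀ i → nodes i ≤ℕ n
  nodes≤n i = ℕ.s≤s⁻¹ (FinP.toℕ<n (a i))
  cs : Vec Carrier r
  cs = proj₁ (newton-form p α)
  p≈cs : ∀ x → eval p x ≈ newton cs α x
  p≈cs = proj₂ (newton-form p α)
  interp : Interpolates cs nodes h
  interp i = trans (sym (p≈cs (α i))) (trans (p-interp i) (reflexive (P.sym (extend-toℕ f (a i)))))
  error-sign′ : (x : Fin (suc n)) → 0# ≤ ((f x ∸F eval p (ι (toℕ x))) * Π[ (λ i → α i ∸F ι (toℕ x)) ])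
  error-sign′ x =
    ≤-respʳ-≈ (*-congʳ (+-cong (reflexive (extend-toℕ f x)) (-‿cong (sym (p≈cs (ι (toℕ x)))))))
      (error-sign h cm cs nodes nodes-inj nodes≤n interp (toℕ x) (ℕ.s≤s⁻¹ (FinP.toℕ<n x)))
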